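{- Let $n\ge 1$ and let $1\le i_1<i_2<\cdots<i_k\le n-1$ be row indices. Then $\eta_n(i_1,i_2,\ldots,i_k)\le A(n-k)$.
   Context: A monotone triangle of size $n$ is a triangular array of integers $\tau=(\tau(i,j))_{1\le j\le i\le n}$, with $i$ entries in row $i$, entries in $[n]$, such that $\tau(i,j)<\tau(i,j+1)$ and $\tau(i,j)\le\tau(i-1,j)\le\tau(i,j+1)$ for $1\le j<i$. $\mathfrak{M}_n$ is the set of these and $A(n)=|\mathfrak{M}_n|$, with $A(0)=1$. Row $i_0$ of $\tau$ is called distinguished if $\tau(i_0,j)=j$ for all $1\le j\le i_0$; $\mathcal{D}(\tau)$ denotes the set of distinguished rows of $\tau$. For $\mathcal{I}=\{i_1,\ldots,i_k\}\subseteq[n-1]$, $\eta_n(i_1,\ldots,i_k)$ is the number of $\tau\in\mathfrak{M}_n$ with $\mathcal{I}\cup\{n\}\subseteq\mathcal{D}(\tau)$. -}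

module Defs where

open import Data.Nat using (ℕ; zero; suc; _≤_; _<_; _≟_; _≤?_; _<?_)
open import Data.Fin using (toℕ)
open import Data.Vec using (Vec; []; _∷_; tabulate)
open import Data.Vec.Properties using (≡-dec)
open import Data.List using (List; [_]; map; concatMap; upTo; filter; length; _∷_)
open import Data.List.Membership.DecPropositional _≟_ using (_∈_; _∈?_)
open import Data.Unit using (⊤; tt)
open import Data.Product using (_×_)
open import Relation.Nullary using (Dec; yes)
open import Relation.Nullary.Decidable using (_×-dec_; _→-dec_)
open import Relation.Binary.PropositionalEquality using (_≡_)

-- A triangular array with m rows; row i (1-based) has i entries.
-- Built by appending rows at the bottom: (t ▷ r) adds row (suc m).
infixl 5 _▷_
data Tri : ℕ → Set where
  []  : Tri zero
  _▷_ : ∀ {m} → Tri m → Vec ℕ (suc m) → Tri (suc m)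

Inc : ∀ {i} → Vec ℕ i → Set
Inc []           = ⊤
Inc (x ∷ [])     = ⊤
Inc (x ∷ y ∷ r)  = x < y × Inc (y ∷ r)

inc? : ∀ {i} (v : Vec ℕ i) → Dec (Inc v)
inc? []          = yes tt
inc? (x ∷ [])    = yes tt
inc? (x ∷ y ∷ r) = (x <? y) ×-dec inc? (y ∷ r)

Interlace : ∀ {i} → Vec ℕ i → Vec ℕ (suc i) → Set
Interlace []       (x ∷ [])     = ⊤
Interlace (p ∷ ps) (x ∷ y ∷ rs) = x ≤ p × p ≤ y × Interlace ps (y ∷ rs)

interlace? : ∀ {i} (p : Vec ℕ i) (r : Vec ℕ (suc i)) → Dec (Interlace p r)
interlace? []       (x ∷ [])     = yes tt
interlace? (p ∷ ps) (x ∷ y ∷ rs) = (x ≤? p) ×-dec ((p ≤? y) ×-dec interlace? ps (y ∷ rs))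

InterlaceLast : ∀ {m} → Tri m → Vec ℕ (suc m) → Set
InterlaceLast []      r = ⊤
InterlaceLast (t ▷ p) r = Interlace p r

interlaceLast? : ∀ {m} (t : Tri m) (r : Vec ℕ (suc m)) → Dec (InterlaceLast t r)
interlaceLast? []      r = yes tt
interlaceLast? (t ▷ p) r = interlace? p r

-- the monotonicity conditions of a monotone triangle (entry range handled by enumeration)
IsMonotone : ∀ {m} → Tri m → Set
IsMonotone []      = ⊤
IsMonotone (t ▷ r) = IsMonotone t × Inc r × InterlaceLast t r

isMonotone? : ∀ {m} (t : Tri m) → Dec (IsMonotone t)
isMonotone? []      = yes tt
isMonotone? (t ▷ r) = isMonotone? t ×-dec (inc? r ×-dec interlaceLast? t r)

allVecs : ℕ → (i : ℕ) → List (Vec ℕ i)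
allVecs n zero    = [ [] ]
allVecs n (suc i) = concatMap (λ x → map (x ∷_) (allVecs n i)) (map suc (upTo n))

allTri : ℕ → (m : ℕ) → List (Tri m)
allTri n zero    = [ [] ]
allTri n (suc m) = concatMap (λ t → map (t ▷_) (allVecs n (suc m))) (allTri n m)

MT : (n : ℕ) → List (Tri n)
MT n = filter isMonotone? (allTri n n)

A : ℕ → ℕ
A n = length (MT n)

idRow : (i : ℕ) → Vec ℕ i
idRow i = tabulate (λ j → suc (toℕ j))

DistinguishedAt : List ℕ → ∀ {m} → Tri m → Set
DistinguishedAt I []              = ⊤
DistinguishedAt I (_▷_ {m} t r)   = (suc m ∈ I → r ≡ idRow (suc m)) × DistinguishedAt I t

distinguishedAt? : (I : List ℕ) → ∀ {m} (t : Tri m) → Dec (DistinguishedAt I t)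
distinguishedAt? I []            = yes tt
distinguishedAt? I (_▷_ {m} t r) =
  ((suc m ∈? I) →-dec ≡-dec _≟_ r (idRow (suc m))) ×-dec distinguishedAt? I t

η : (n : ℕ) → List ℕ → ℕ
η n I = length (filter (distinguishedAt? (n ∷ I)) (MT n))

module Submission where

-- The heart of the proof is a row-deletion map.  Let τ be a monotone
-- triangle of size n+1 whose rows n+1 and i (1 ≤ i ≤ n) are distinguished.
-- Interlacing with the distinguished row i = (1,…,i) forces every row
-- r > i to begin with 1,2,…,i.  Deleting row i, dropping the leading 1 of
-- every lower row and decrementing the rest of it, yields a monotone
-- triangle of size n whose rows n and j-1 (for every distinguished j > i)
-- are distinguished; and τ can be recovered from the result.  Hence
--   η_{n+1}(i, j₁, …, j_l) ≤ η_n(j₁-1, …, j_l-1),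
-- and k applications of this step, followed by η_m() ≤ A(m), give the claim.

open import Defs
open import Data.Nat using (ℕ; zero; suc; _≤_; _<_; _∸_; _+_; pred; z≤n; s≤s; s≤s⁻¹; _≟_)
open import Data.Nat.Properties
open import Data.Fin using (toℕ)
open import Data.Vec as V using (Vec; []; _∷_; toList)
open import Data.Vec.Relation.Unary.All as VA using (All; []; _∷_)
open import Data.Vec.Properties using (∷-injective; tabulate-cong; toList-map)
open import Data.List as L using (List; length; upTo; filter; cartesianProductWith; concatMap; _++_)
open import Data.List.Relation.Unary.Any using (here; there)
import Data.List.Relation.Unary.All as LA
open import Data.List.Relation.Unary.AllPairs using ([]; _∷_)
open import Data.List.Relation.Unary.Unique.Propositional using (Unique)
import Data.List.Relation.Unary.Unique.Propositional.Properties as Unique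
open import Data.List.Membership.Propositional using (_∈_)
open import Data.List.Membership.Propositional.Properties
open import Data.List.Properties using (length-filter)
open import Data.Product using (_×_; _,_; proj₁; proj₂; ∃)
open import Data.Unit using (⊤; tt)
open import Data.Empty using (⊥-elim)
open import Relation.Nullary using (yes; no)
open import Relation.Binary.PropositionalEquality

removeOne : ∀ {A : Set} {x : A} (ys : List A) → x ∈ ys →
  ∃ λ ys' → suc (length ys') ≡ length ys × (∀ {y} → y ∈ ys → y ≢ x → y ∈ ys')
removeOne (y L.∷ ys) (here refl) =
  ys , refl , λ { (here refl) y≢x → ⊥-elim (y≢x refl) ; (there y∈) _ → y∈ }
removeOne (y L.∷ ys) (there x∈) with removeOne ys x∈
... | ys' , len , keep =
  y L.∷ ys' , cong suc len , λ { (here refl) _ → here refl ; (there z∈) z≢x → there (keep z∈ z≢x) }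

injection⇒length≤ : ∀ {A B : Set} (f : A → B) {xs : List A} {ys : List B} → Unique xs →
  (∀ {x y} → x ∈ xs → y ∈ xs → f x ≡ f y → x ≡ y) → (∀ {x} → x ∈ xs → f x ∈ ys) →
  length xs ≤ length ys
injection⇒length≤ f {L.[]} [] _ _ = z≤n
injection⇒length≤ f {x L.∷ xs} {ys} (x∉xs ∷ u) inj into with removeOne ys (into (here refl))
... | ys' , len , keep = subst (suc (length xs) ≤_) len
  (s≤s (injection⇒length≤ f u (λ a b → inj (there a) (there b))
     (λ y∈ → keep (into (there y∈))
        (λ fy≡fx → LA.lookup x∉xs y∈ (sym (inj (there y∈) (here refl) fy≡fx))))))

InRange : ℕ → ℕ → Set
InRange N x = 1 ≤ x × x ≤ N

EntriesIn : ℕ → ∀ {m} → Tri m → Set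
EntriesIn N []      = ⊤
EntriesIn N (t ▷ r) = EntriesIn N t × All (InRange N) r

-- The enumerations are written with concatMap; the library's lemmas are
-- about cartesianProductWith.
concatMap≡cartesianProductWith : ∀ {A B C : Set} (f : A → B → C) xs ys →
  concatMap (λ x → L.map (f x) ys) xs ≡ cartesianProductWith f xs ys
concatMap≡cartesianProductWith f L.[]       ys = refl
concatMap≡cartesianProductWith f (x L.∷ xs) ys =
  cong (L.map (f x) ys ++_) (concatMap≡cartesianProductWith f xs ys)

allVecs-suc : ∀ N i →
  allVecs N (suc i) ≡ cartesianProductWith _∷_ (L.map suc (upTo N)) (allVecs N i)
allVecs-suc N i = concatMap≡cartesianProductWith _∷_ (L.map suc (upTo N)) (allVecs N i)

allTri-suc : ∀ N m → allTri N (suc m) ≡ cartesianProductWith _▷_ (allTri N m) (allVecs N (suc m))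
allTri-suc N m = concatMap≡cartesianProductWith _▷_ (allTri N m) (allVecs N (suc m))

▷-injective : ∀ {m} {t t' : Tri m} {r r'} → t ▷ r ≡ t' ▷ r' → t ≡ t' × r ≡ r'
▷-injective refl = refl , refl

allVecs-unique : ∀ N i → Unique (allVecs N i)
allVecs-unique N zero    = LA.[] ∷ []
allVecs-unique N (suc i) =
  subst Unique (sym (allVecs-suc N i))
    (Unique.cartesianProductWith⁺ _∷_ ∷-injective
      (Unique.map⁺ suc-injective (Unique.upTo⁺ N)) (allVecs-unique N i))

allTri-unique : ∀ N m → Unique (allTri N m)
allTri-unique N zero    = LA.[] ∷ []
allTri-unique N (suc m) =
  subst Unique (sym (allTri-suc N m))
    (Unique.cartesianProductWith⁺ _▷_ ▷-injective (allTri-unique N m) (allVecs-unique N (suc m)))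

∈-allVecs⁻ : ∀ N i {v} → v ∈ allVecs N i → All (InRange N) v
∈-allVecs⁻ N zero    (here refl) = []
∈-allVecs⁻ N (suc i) v∈
  with a , w , a∈ , w∈ , refl ← ∈-cartesianProductWith⁻ _∷_ (L.map suc (upTo N)) (allVecs N i)
         (subst (_ ∈_) (allVecs-suc N i) v∈)
  with x , x∈ , refl ← ∈-map⁻ suc a∈
  = (s≤s z≤n , ∈-upTo⁻ x∈) ∷ ∈-allVecs⁻ N i w∈

∈-allVecs⁺ : ∀ N i {v} → All (InRange N) v → v ∈ allVecs N i
∈-allVecs⁺ N zero    [] = here refl
∈-allVecs⁺ N (suc i) {suc x ∷ v} ((_ , x<N) ∷ vs) =
  subst (_ ∈_) (sym (allVecs-suc N i))
    (∈-cartesianProductWith⁺ _∷_ (∈-map⁺ suc (∈-upTo⁺ x<N)) (∈-allVecs⁺ N i vs))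

∈-allTri⁻ : ∀ N m {t} → t ∈ allTri N m → EntriesIn N t
∈-allTri⁻ N zero    (here refl) = tt
∈-allTri⁻ N (suc m) t∈
  with s , r , s∈ , r∈ , refl ← ∈-cartesianProductWith⁻ _▷_ (allTri N m) (allVecs N (suc m))
         (subst (_ ∈_) (allTri-suc N m) t∈)
  = ∈-allTri⁻ N m s∈ , ∈-allVecs⁻ N (suc m) r∈

∈-allTri⁺ : ∀ N m {t} → EntriesIn N t → t ∈ allTri N m
∈-allTri⁺ N zero    {[]}    _ = here refl
∈-allTri⁺ N (suc m) {t ▷ r} (bt , br) =
  subst (_ ∈_) (sym (allTri-suc N m))
    (∈-cartesianProductWith⁺ _▷_ (∈-allTri⁺ N m bt) (∈-allVecs⁺ N (suc m) br))

Admissible : List ℕ → ℕ → ∀ {m} → Tri m → Set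
Admissible I N t = IsMonotone t × DistinguishedAt I t × EntriesIn N t

Admissible-init : ∀ {I N m} {t : Tri m} {r} → Admissible I N (t ▷ r) → Admissible I N t
Admissible-init ((mono , _ , _) , (_ , dist) , (bounds , _)) = mono , dist , bounds

Counted : (n : ℕ) → List ℕ → List (Tri n)
Counted n I = filter (distinguishedAt? I) (MT n)

counted-unique : ∀ n I → Unique (Counted n I)
counted-unique n I =
  Unique.filter⁺ (distinguishedAt? I) (Unique.filter⁺ isMonotone? (allTri-unique n n))

∈-counted⁻ : ∀ {n I} {t : Tri n} → t ∈ Counted n I → Admissible I n t
∈-counted⁻ {n} {I} t∈ =
  let t∈MT , dist = ∈-filter⁻ (distinguishedAt? I) t∈
      t∈all , mono = ∈-filter⁻ isMonotone? t∈MT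
  in mono , dist , ∈-allTri⁻ n n t∈all

∈-counted⁺ : ∀ n I {t : Tri n} → Admissible I n t → t ∈ Counted n I
∈-counted⁺ n I (mono , dist , bounds) =
  ∈-filter⁺ (distinguishedAt? I) (∈-filter⁺ isMonotone? (∈-allTri⁺ n n bounds) mono) dist

consecutive : ℕ → (l : ℕ) → Vec ℕ l
consecutive a zero    = []
consecutive a (suc l) = a ∷ consecutive (suc a) l

tabulate≡consecutive : ∀ a l → V.tabulate {n = l} (λ j → a + toℕ j) ≡ consecutive a l
tabulate≡consecutive a zero    = refl
tabulate≡consecutive a (suc l) = cong₂ _∷_ (+-identityʳ a)
  (trans (tabulate-cong (λ j → +-suc a (toℕ j))) (tabulate≡consecutive (suc a) l))

idRow≡consecutive : ∀ i → idRow i ≡ consecutive 1 i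
idRow≡consecutive = tabulate≡consecutive 1

consecutive-≤ : ∀ a l {k} → a + l ≤ suc k → All (_≤ k) (consecutive a l)
consecutive-≤ a zero    _  = []
consecutive-≤ a (suc l) {k} le = s≤s⁻¹ (≤-trans (s≤s (m≤m+n a l)) le′) ∷ consecutive-≤ (suc a) l le′
  where
  le′ : suc a + l ≤ suc k
  le′ = subst (_≤ suc k) (+-suc a l) le

-- Lowering a row: drop its leading entry and decrement the others.  This is
-- what happens to the rows below the deleted one.
lowerRow : ∀ {m} → Vec ℕ (suc m) → Vec ℕ m
lowerRow r = V.map pred (V.tail r)

map-pred-consecutive : ∀ a l → V.map pred (consecutive (suc a) l) ≡ consecutive a l
map-pred-consecutive a zero    = refl
map-pred-consecutive a (suc l) = cong (a ∷_) (map-pred-consecutive (suc a) l)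

lowerRow-idRow : ∀ k → lowerRow (idRow (suc k)) ≡ idRow k
lowerRow-idRow k = begin
  lowerRow (idRow (suc k))             ≡⟨ cong lowerRow (idRow≡consecutive (suc k)) ⟩
  V.map pred (consecutive 2 k)         ≡⟨ map-pred-consecutive 1 k ⟩
  consecutive 1 k                      ≡⟨ idRow≡consecutive k ⟨
  idRow k                              ∎
  where open ≡-Reasoning

map-suc-pred : ∀ {l N} {xs : Vec ℕ l} → All (InRange N) xs → V.map suc (V.map pred xs) ≡ xs
map-suc-pred {xs = []}         []                  = refl
map-suc-pred {xs = suc x ∷ xs} ((s≤s _ , _) ∷ inR) = cong (suc x ∷_) (map-suc-pred inR)

lowerRow-injective : ∀ {l N} (r r′ : Vec ℕ (suc l)) → V.head r ≡ 1 → V.head r′ ≡ 1 →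
  All (InRange N) r → All (InRange N) r′ → lowerRow r ≡ lowerRow r′ → r ≡ r′
lowerRow-injective (x ∷ xs) (x′ ∷ xs′) refl refl (_ ∷ inR) (_ ∷ inR′) eq = cong (1 ∷_) (begin
  xs                             ≡⟨ map-suc-pred inR ⟨
  V.map suc (V.map pred xs)      ≡⟨ cong (V.map suc) eq ⟩
  V.map suc (V.map pred xs′)     ≡⟨ map-suc-pred inR′ ⟩
  xs′                            ∎)
  where open ≡-Reasoning

Inc-head< : ∀ {l x} {xs : Vec ℕ l} → Inc (x ∷ xs) → All (x <_) xs
Inc-head< {xs = []}     _            = []
Inc-head< {xs = y ∷ ys} (x<y , incY) = x<y ∷ VA.map (<-trans x<y) (Inc-head< incY)

Inc-tail : ∀ {l x} {xs : Vec ℕ l} → Inc (x ∷ xs) → Inc xs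
Inc-tail {xs = []}     _         = tt
Inc-tail {xs = y ∷ ys} (_ , inc) = inc

Inc-map-pred : ∀ {l} {v : Vec ℕ l} → Inc v → All (1 ≤_) v → Inc (V.map pred v)
Inc-map-pred {v = []}              _           _        = tt
Inc-map-pred {v = x ∷ []}          _           _        = tt
Inc-map-pred {v = suc x ∷ y ∷ r}   (x<y , inc) (_ ∷ pos) = pred-mono-< x<y , Inc-map-pred inc pos

Inc-lowerRow : ∀ {l N} (r : Vec ℕ (suc l)) → Inc r → All (InRange N) r → Inc (lowerRow r)
Inc-lowerRow (x ∷ xs) inc (_ ∷ inR) = Inc-map-pred (Inc-tail inc) (VA.map proj₁ inR)

map-pred-inRange : ∀ {l N} {xs : Vec ℕ l} → All (1 <_) xs → All (_≤ suc N) xs →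
  All (InRange N) (V.map pred xs)
map-pred-inRange {xs = []}               []         []              = []
map-pred-inRange {xs = suc (suc y) ∷ ys} (_ ∷ gt)   (s≤s y≤N ∷ le)  = (s≤s z≤n , y≤N) ∷ map-pred-inRange gt le
map-pred-inRange {xs = suc zero ∷ ys}    (s≤s () ∷ _) _

Interlace-map-pred : ∀ {l} {p : Vec ℕ l} {r} → Interlace p r → Interlace (V.map pred p) (V.map pred r)
Interlace-map-pred {p = []}     {x ∷ []}     _             = tt
Interlace-map-pred {p = _ ∷ _}  {x ∷ y ∷ rs} (a , b , rest) = pred-mono-≤ a , pred-mono-≤ b , Interlace-map-pred rest

Interlace-tail : ∀ {l} {p : Vec ℕ (suc l)} {r} → Interlace p r → Interlace (V.tail p) (V.tail r)
Interlace-tail {p = _ ∷ _} {x ∷ y ∷ rs} (_ , _ , rest) = rest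

Interlace-≤ : ∀ {l M} {q : Vec ℕ l} {p} → Interlace q p → All (_≤ M) p → All (_≤ M) q
Interlace-≤ {q = []}     _                  _                  = []
Interlace-≤ {q = _ ∷ _}  {x ∷ y ∷ rs} (_ , q≤y , rest) (_ ∷ y≤M ∷ le) =
  ≤-trans q≤y y≤M ∷ Interlace-≤ rest (y≤M ∷ le)

-- StartsAt a r: r = (a, a+1, …, a+l-1, y) with y ≥ a+l.
StartsAt : ℕ → ∀ {l} → Vec ℕ (suc l) → Set
StartsAt a (y ∷ [])    = a ≤ y
StartsAt a (x ∷ y ∷ r) = x ≡ a × StartsAt (suc a) (y ∷ r)

StartsAt-head : ∀ {a l} (r : Vec ℕ (suc l)) → StartsAt a r → a ≤ V.head r
StartsAt-head (y ∷ [])    a≤y      = a≤y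
StartsAt-head (x ∷ y ∷ r) (refl , _) = ≤-refl

startsAt : ∀ a l (r : Vec ℕ (suc l)) → Interlace (consecutive a l) r → a ≤ V.head r → Inc r →
  StartsAt a r
startsAt a zero    (y ∷ [])     _                 a≤y _           = a≤y
startsAt a (suc l) (x ∷ y ∷ rs) (x≤a , a≤y , rest) a≤x (x<y , inc) =
  ≤-antisym x≤a a≤x , startsAt (suc a) l (y ∷ rs) rest (≤-trans (s≤s a≤x) x<y) inc

Interlace-across : ∀ a l (q : Vec ℕ l) (r : Vec ℕ (suc (suc l))) →
  Interlace q (consecutive a (suc l)) → StartsAt a r → Interlace q (lowerRow r)
Interlace-across a zero    []        (x ∷ y ∷ [])     _                    _            = tt
Interlace-across a (suc l) (q₀ ∷ qs) (x ∷ y ∷ z ∷ rs) (a≤q₀ , q₀≤a+1 , rest) (_ , refl , st) =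
  a≤q₀ , ≤-trans q₀≤a+1 (pred-mono-≤ (StartsAt-head (z ∷ rs) st)) ,
  Interlace-across (suc a) l qs (y ∷ z ∷ rs) rest (refl , st)

EntriesIn-above : ∀ {m N M} (t : Tri m) (p : Vec ℕ (suc m)) →
  IsMonotone (t ▷ p) → EntriesIn N (t ▷ p) → All (_≤ M) p → EntriesIn M t
EntriesIn-above []      p _               _          _   = tt
EntriesIn-above {M = M} (t ▷ q) p (mono , _ , q⋈p) (bounds , _) p≤M =
  EntriesIn-above t q mono bounds q≤M , tighten (proj₂ bounds) q≤M
  where
  q≤M : All (_≤ M) q
  q≤M = Interlace-≤ q⋈p p≤M
  tighten : ∀ {l N M} {v : Vec ℕ l} → All (InRange N) v → All (_≤ M) v → All (InRange M) v
  tighten []              []           = []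
  tighten ((1≤x , _) ∷ v) (x≤M ∷ v≤M) = (1≤x , x≤M) ∷ tighten v v≤M

deleteRow : ℕ → ∀ {m} → Tri (suc m) → Tri m
deleteRow i ([] ▷ r)                = []
deleteRow i {suc m} ((t ▷ p) ▷ r) with i ≟ suc (suc m)
... | yes _ = t ▷ p
... | no  _ = deleteRow i (t ▷ p) ▷ lowerRow r

module DeleteDistinguished (i : ℕ) (I : List ℕ) (i∈I : i ∈ I) where

  row-i : ∀ {m} {t : Tri m} {p} → i ≡ suc m → DistinguishedAt I (t ▷ p) → p ≡ consecutive 1 (suc m)
  row-i {m} refl dist = trans (proj₁ dist i∈I) (idRow≡consecutive (suc m))

  leadingOne : ∀ {m N} (t : Tri m) (p : Vec ℕ (suc m)) → 1 ≤ i → i < suc m →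
    Admissible I N (t ▷ p) → V.head p ≡ 1
  leadingOne [] p 1≤i (s≤s i≤0) _ with ≤-trans 1≤i i≤0
  ... | ()
  leadingOne (_▷_ {m} t (q₀ ∷ qs)) (x ∷ y ∷ rs) 1≤i i<m+2
             adm@((_ , inc , q⋈p) , (_ , dist) , (_ , (1≤x , _) ∷ _)) with i ≟ suc m
  ... | yes i≡ =
    proj₁ (startsAt 1 (suc m) (x ∷ y ∷ rs) (subst (λ v → Interlace v (x ∷ y ∷ rs)) (row-i i≡ dist) q⋈p) 1≤x inc)
  ... | no  i≢ = ≤-antisym (subst (x ≤_) q₀≡1 (proj₁ q⋈p)) 1≤x
    where
    q₀≡1 : q₀ ≡ 1
    q₀≡1 = leadingOne t (q₀ ∷ qs) 1≤i (≤∧≢⇒< (s≤s⁻¹ i<m+2) i≢) (Admissible-init adm)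

  InterlaceLast-deleteRow : ∀ {m} (t : Tri (suc m)) (r : Vec ℕ (suc (suc m))) →
    IsMonotone t → DistinguishedAt I t → 1 ≤ V.head r → Inc r → InterlaceLast t r →
    InterlaceLast (deleteRow i t) (lowerRow r)
  InterlaceLast-deleteRow ([] ▷ p) r _ _ _ _ _ = tt
  InterlaceLast-deleteRow {suc m} ((t ▷ q) ▷ p) r (_ , _ , q⋈p) dist 1≤r inc p⋈r with i ≟ suc (suc m)
  ... | yes i≡ = Interlace-across 1 (suc m) q r (subst (Interlace q) p≡ q⋈p)
                   (startsAt 1 (suc (suc m)) r (subst (λ v → Interlace v r) p≡ p⋈r) 1≤r inc)
    where
    p≡ : p ≡ consecutive 1 (suc (suc m))
    p≡ = row-i i≡ dist
  ... | no  _  = Interlace-map-pred (Interlace-tail {p = p} p⋈r)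

  deleteRow-monotone : ∀ {m N} (t : Tri (suc m)) → Admissible I N t → IsMonotone (deleteRow i t)
  deleteRow-monotone ([] ▷ p) _ = tt
  deleteRow-monotone {suc m} ((t ▷ q) ▷ (x ∷ xs)) adm@((mono , inc , q⋈p) , (_ , dist) , (_ , bp@((1≤x , _) ∷ _)))
    with i ≟ suc (suc m)
  ... | yes _ = mono
  ... | no  _ = deleteRow-monotone (t ▷ q) (Admissible-init adm) ,
                Inc-lowerRow (x ∷ xs) inc bp ,
                InterlaceLast-deleteRow (t ▷ q) (x ∷ xs) mono dist 1≤x inc q⋈p

  -- Entries in [N+1] become entries in [N]: rows above i lie below the
  -- distinguished row (1,…,i) with i ≤ N, lowered rows lose their entry 1.
  deleteRow-entries : ∀ {m N} (t : Tri (suc m)) → i ≤ N → Admissible I (suc N) t →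
    EntriesIn N (deleteRow i t)
  deleteRow-entries ([] ▷ p) _ _ = tt
  deleteRow-entries {suc m} {N} ((t ▷ q) ▷ (x ∷ xs)) i≤N
                    adm@(mono@(_ , inc , _) , dist , bounds@(_ , (1≤x , _) ∷ bxs)) with i ≟ suc (suc m)
  ... | yes i≡ = EntriesIn-above (t ▷ q) (x ∷ xs) mono bounds
                   (subst (All (_≤ N)) (sym (row-i i≡ dist))
                     (consecutive-≤ 1 (suc (suc m)) (s≤s (subst (_≤ N) i≡ i≤N))))
  ... | no  _  = deleteRow-entries (t ▷ q) i≤N (Admissible-init adm) ,
                 map-pred-inRange (VA.map (≤-<-trans 1≤x) (Inc-head< inc)) (VA.map proj₂ bxs)

  -- The deletion is injective: row i is known, and lowered rows began with 1.
  deleteRow-injective : ∀ {m N} (t t′ : Tri (suc m)) → 1 ≤ i → i ≤ suc m →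
    Admissible I N t → Admissible I N t′ → deleteRow i t ≡ deleteRow i t′ → t ≡ t′
  deleteRow-injective ([] ▷ p) ([] ▷ p′) 1≤i i≤1 (_ , dist , _) (_ , dist′ , _) _ =
    cong ([] ▷_) (trans (row-i i≡1 dist) (sym (row-i i≡1 dist′)))
    where
    i≡1 : i ≡ 1
    i≡1 = ≤-antisym i≤1 1≤i
  deleteRow-injective {suc m} ((t ▷ q) ▷ p) ((t′ ▷ q′) ▷ p′) 1≤i i≤m+2
                      adm@(_ , dist , _ , bp) adm′@(_ , dist′ , _ , bp′) eq with i ≟ suc (suc m)
  ... | yes i≡ = cong₂ _▷_ eq (trans (row-i i≡ dist) (sym (row-i i≡ dist′)))
  ... | no  i≢ = cong₂ _▷_
      (deleteRow-injective (t ▷ q) (t′ ▷ q′) 1≤i (s≤s⁻¹ i<) (Admissible-init adm) (Admissible-init adm′) upper≡)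
      (lowerRow-injective p p′ (leadingOne (t ▷ q) p 1≤i i< adm) (leadingOne (t′ ▷ q′) p′ 1≤i i< adm′)
         bp bp′ lowered≡)
    where
    i< : i < suc (suc m)
    i< = ≤∧≢⇒< i≤m+2 i≢
    upper≡ : deleteRow i (t ▷ q) ≡ deleteRow i (t′ ▷ q′)
    upper≡ = proj₁ (▷-injective eq)
    lowered≡ : lowerRow p ≡ lowerRow p′
    lowered≡ = proj₂ (▷-injective eq)

distinguishedAt-short : ∀ {I i m} (t : Tri m) → (∀ {x} → x ∈ I → i ≤ x) → m < i → DistinguishedAt I t
distinguishedAt-short []              _   _   = tt
distinguishedAt-short (_▷_ {m} t r) I≥i m<i =
  (λ m+1∈I → ⊥-elim (<-irrefl refl (<-≤-trans m<i (I≥i m+1∈I)))) ,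
  distinguishedAt-short t I≥i (<-trans (n<1+n m) m<i)

deleteRow-distinguished : ∀ i {I I′ m} (t : Tri (suc m)) → (∀ {x} → x ∈ I′ → i ≤ x) →
  (∀ {x} → x ∈ I′ → suc x ∈ I) → DistinguishedAt I t → DistinguishedAt I′ (deleteRow i t)
deleteRow-distinguished i ([] ▷ p) _ _ _ = tt
deleteRow-distinguished i {m = suc m} ((t ▷ q) ▷ p) I′≥i shift (p≡ , dist) with i ≟ suc (suc m)
... | yes refl = distinguishedAt-short (t ▷ q) I′≥i ≤-refl
... | no  _    = (λ x∈I′ → trans (cong lowerRow (p≡ (shift x∈I′))) (lowerRow-idRow (suc m))) ,
                 deleteRow-distinguished i (t ▷ q) I′≥i shift dist

η-step : ∀ n i J → 1 ≤ i → i ≤ n → (∀ {j} → j ∈ J → i < j) →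
  η (suc n) (i L.∷ J) ≤ η n (L.map pred J)
η-step n i J 1≤i i≤n i<J =
  injection⇒length≤ (deleteRow i) (counted-unique (suc n) I)
    (λ t∈ t′∈ → deleteRow-injective _ _ 1≤i (m≤n⇒m≤1+n i≤n) (∈-counted⁻ t∈) (∈-counted⁻ t′∈))
    (λ {t} t∈ → let adm@(_ , dist , _) = ∈-counted⁻ t∈ in
      ∈-counted⁺ n I′ (deleteRow-monotone t adm ,
                       deleteRow-distinguished i t I′≥i shift dist ,
                       deleteRow-entries t i≤n adm))
  where
  I I′ : List ℕ
  I  = suc n L.∷ i L.∷ J
  I′ = n L.∷ L.map pred J
  open DeleteDistinguished i I (there (here refl))

  I′≥i : ∀ {x} → x ∈ I′ → i ≤ x
  I′≥i (here refl) = i≤n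
  I′≥i (there x∈) with j , j∈ , refl ← ∈-map⁻ pred x∈ = <⇒≤pred (i<J j∈)

  shift : ∀ {x} → x ∈ I′ → suc x ∈ I
  shift (here refl) = here refl
  shift (there x∈) with j , j∈ , refl ← ∈-map⁻ pred x∈ with i<J j∈
  ... | s≤s _ = there (there j∈)

∈-toList⁻ : ∀ {P : ℕ → Set} {k} {v : Vec ℕ k} → All P v → ∀ {x} → x ∈ toList v → P x
∈-toList⁻ (px ∷ _)  (here refl) = px
∈-toList⁻ (_  ∷ ps) (there x∈)  = ∈-toList⁻ ps x∈

-- The indices after the first, decremented, again lie in [1, n-1] of the
-- smaller size, since they exceed the first index i ≥ 1.
lowered-indices : ∀ {l n i} {v : Vec ℕ l} → 1 ≤ i → All (i <_) v →
  All (λ x → 1 ≤ x × x ≤ suc n ∸ 1) v → All (λ x → 1 ≤ x × x ≤ n ∸ 1) (V.map pred v)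
lowered-indices _   []      []                 = []
lowered-indices {v = suc (suc x) ∷ v} 1≤i (_ ∷ gt) ((_ , x≤n) ∷ bs) =
  (s≤s z≤n , ∸-monoˡ-≤ 1 x≤n) ∷ lowered-indices 1≤i gt bs
lowered-indices {v = suc zero ∷ v} 1≤i (i<1 ∷ _) _ with ≤-trans (s≤s 1≤i) i<1
... | s≤s ()

corollary1 : (n k : ℕ) (is : Vec ℕ k) → 1 ≤ n → Inc is →
    All (λ i → 1 ≤ i × i ≤ n ∸ 1) is →
    η n (toList is) ≤ A (n ∸ k)
corollary1 n zero [] _ _ _ = length-filter (distinguishedAt? (n L.∷ L.[])) (MT n)
corollary1 (suc n) (suc k) (i ∷ is) _ inc ((1≤i , i≤n) ∷ bs) = begin
  η (suc n) (i L.∷ toList is)        ≤⟨ η-step n i (toList is) 1≤i i≤n (∈-toList⁻ i<is) ⟩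
  η n (L.map pred (toList is))       ≡⟨ cong (η n) (toList-map pred is) ⟨
  η n (toList (V.map pred is))       ≤⟨ corollary1 n k (V.map pred is) (≤-trans 1≤i i≤n)
                                          (Inc-map-pred (Inc-tail inc) (VA.map proj₁ bs))
                                          (lowered-indices 1≤i i<is bs) ⟩
  A (n ∸ k)                          ∎
  where
  open ≤-Reasoning
  i<is : All (i <_) is
  i<is = Inc-head< inc
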